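{- Let $G$ be a graph (irreflexive and symmetric) with vertex set $V$. The Boolean dimension of $G$ equals the smallest integer $m\in\mathbb N$ for which there exist subsets $X_0,\dots,X_{m-1}$ of $V$ such that, for every pair $e=\{x,y\}$ of distinct elements of $V$, $e$ is an edge of $G$ if and only if the number of indices $i<m$ with $e\subseteq X_i$ is odd. If $G$ has $n$ vertices, its Boolean dimension is at most $n-1$, and this maximum value is attained by any path, i.e. by any graph on $n$ vertices whose edges form a path through all $n$ vertices.
   Context: For a graph $G$ on $V$ write $G(x,y)=1$ if $\{x,y\}$ is an edge and $0$ otherwise. A representation of $G$ in $(\mathbb F_2)^m$ is a map $f:V\to(\mathbb F_2)^m$ such that $G(x,y)=\varphi(f(x),f(y))$ for all distinct $x,y\in V$, where $\varphi(u,v)=\sum_{i<m}u_iv_i \pmod 2$ is the standard scalar product. The Boolean dimension of $G$ is the least integer $m$ such that $G$ admits a representation in $(\mathbb F_2)^m$ (with this $\varphi$). -}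

module Defs where

open import Data.Bool using (Bool; true; false; _∧_; _xor_)
open import Data.Nat using (ℕ; zero; suc; _+_; _<_; _%_)
open import Data.Fin using (Fin; toℕ) renaming (zero to fzero; suc to fsuc)
open import Data.Product using (Σ; _×_; ∃; ∃-syntax)
open import Data.Sum using (_⊎_)
open import Relation.Binary.PropositionalEquality using (_≡_; _≢_)
open import Relation.Nullary using (¬_)
open import Function.Bundles using (_⇔_)
open import Function.Definitions using (Injective)

record Graph (V : Set) : Set where
  field
    adj   : V → V → Bool
    sym   : ∀ x y → adj x y ≡ adj y x
    irrefl : ∀ x → adj x x ≡ false
open Graph public

-- (F₂)^m as functions Fin m → Bool; F₂ addition is xor, multiplication is ∧.
-- Standard scalar product φ(u,v) = Σ_{i<m} u_i v_i (mod 2).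
φ : ∀ {m} → (Fin m → Bool) → (Fin m → Bool) → Bool
φ {zero}  u v = false
φ {suc m} u v = (u fzero ∧ v fzero) xor φ (λ i → u (fsuc i)) (λ i → v (fsuc i))

Representation : ∀ {V} → Graph V → (m : ℕ) → (V → Fin m → Bool) → Set
Representation G m f = ∀ x y → x ≢ y → adj G x y ≡ φ (f x) (f y)

Representable : ∀ {V} → Graph V → ℕ → Set
Representable G m = ∃[ f ] Representation G m f

IsBooleanDimension : ∀ {V} → Graph V → ℕ → Set
IsBooleanDimension G m = Representable G m × (∀ k → k < m → ¬ Representable G k)

count : ∀ {m} → (Fin m → Bool) → ℕ
count {zero}  b = 0
count {suc m} b with b fzero
... | true  = suc (count (λ i → b (fsuc i)))
... | false = count (λ i → b (fsuc i))

Odd : ℕ → Set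
Odd k = k % 2 ≡ 1

SubsetCover : ∀ {V} → Graph V → (m : ℕ) → (Fin m → V → Bool) → Set
SubsetCover G m X = ∀ x y → x ≢ y →
  (adj G x y ≡ true ⇔ Odd (count (λ i → X i x ∧ X i y)))

HasSubsetCover : ∀ {V} → Graph V → ℕ → Set
HasSubsetCover G m = ∃[ X ] SubsetCover G m X

IsLeastSubsetCoverSize : ∀ {V} → Graph V → ℕ → Set
IsLeastSubsetCoverSize G m = HasSubsetCover G m × (∀ k → k < m → ¬ HasSubsetCover G k)

IsPath : ∀ {n} → Graph (Fin n) → Set
IsPath {n} G = ∃[ σ ] (Injective _≡_ _≡_ σ ×
  (∀ (i j : Fin n) → (adj G (σ i) (σ j) ≡ true ⇔ (suc (toℕ i) ≡ toℕ j ⊎ suc (toℕ j) ≡ toℕ i))))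

-- Since φ(u,v) is the parity of the number of coordinates where u and v are both 1,
-- a representation f in (F₂)^m is the same thing as the family of sets
-- X_i = {x ∣ f(x)_i = 1}, so both notions of dimension are least elements of the same set.
--
-- Upper bound: send a vertex v₀ to the unit vector e₀ and every other vertex y to a vector
-- with first coordinate G(v₀,y); the remaining coordinates must then represent the symmetric
-- matrix G(x,y) + G(v₀,x) G(v₀,y) on the other n - 1 vertices, which recursively takes n - 2.
-- A least dimension exists because representability in a fixed dimension is decidable by a
-- finite search.
--
-- Lower bound: along a path v₀, …, v_n, the vectors u_i = f(v_i) and w_i = f(v_{i+1}) satisfy
-- φ(u_i,w_i) = 1 and φ(u_i,w_j) = 0 for i < j.  Such a triangular system of length n needs
-- n coordinates: eliminating a coordinate c with u₀(c) = 1 from u₁, …, u_{n-1} (adding a multiple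
-- of u₀, which is orthogonal to w₁, …, w_{n-1}) leaves a triangular system of length n - 1
-- in one dimension fewer.
module Submission where

open import Defs hiding (sym)
open import Data.Nat using (ℕ; _≤_; _∸_)
open import Data.Fin using (Fin)
open import Data.Product using (_×_; ∃-syntax)
open import Function.Bundles using (_⇔_)

open import Data.Bool using (Bool; true; false; not; _∧_; _xor_)
open import Data.Bool.Properties
  using ( xor-identityʳ; xor-same; xor-assoc; xor-comm; ∧-identityʳ; ∧-zeroʳ; ∧-comm
        ; ∧-distribʳ-xor; ¬-not)
  renaming (_≟_ to _≟ᵇ_)
open import Data.Nat using (zero; suc; _<_; z≤n; s≤s)
open import Data.Nat.Properties using (1+n≢n; suc-injective; <⇒≢; <⇒≱; m<n⇒m<1+n; n≤1+n)
open import Data.Fin using (toℕ; inject₁; punchIn) renaming (zero to fzero; suc to fsuc; _<_ to _<ᶠ_)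
open import Data.Fin.Properties using (all?; toℕ-inject₁) renaming (_≟_ to _≟ᶠ_)
open import Data.Vec using (Vec; []; _∷_; lookup; tabulate)
open import Data.Vec.Properties using (lookup∘tabulate)
open import Data.Vec.Functional using (replicate) renaming (_∷_ to _◂_)
open import Data.Product using (∃; _,_; proj₁; proj₂)
open import Data.Sum using (_⊎_; inj₁; inj₂)
open import Data.Empty using (⊥-elim)
open import Function using (_∘_)
open import Function.Bundles using (mk⇔; Equivalence)
open import Function.Construct.Composition using (_⇔-∘_)
open import Function.Construct.Symmetry using (⇔-sym)
open import Function.Definitions using (Injective)
open import Relation.Nullary using (¬_; Dec; yes; no)
open import Relation.Nullary.Decidable using (map′; ¬?; _⊎-dec_; _→-dec_)
open import Relation.Unary using (Decidable)
open import Relation.Binary.PropositionalEquality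
  using (_≡_; _≢_; refl; sym; trans; cong; cong₂; subst; module ≡-Reasoning)

open Equivalence using (to; from)
open ≡-Reasoning

private
  variable
    k m n : ℕ

Vector : ℕ → Set
Vector k = Fin k → Bool

infixl 6 _⊕_
infixl 7 _·_

_⊕_ : Vector k → Vector k → Vector k
(u ⊕ v) i = u i xor v i

_·_ : Bool → Vector k → Vector k
(β · v) i = β ∧ v i

dropCoordinate : Fin (suc k) → Vector (suc k) → Vector k
dropCoordinate c v = v ∘ punchIn c

φ-cong : {u u′ v v′ : Vector k} → (∀ i → u i ≡ u′ i) → (∀ i → v i ≡ v′ i) →
         φ u v ≡ φ u′ v′
φ-cong {zero}  _   _   = refl
φ-cong {suc k} u≗u′ v≗v′ =
  cong₂ _xor_ (cong₂ _∧_ (u≗u′ fzero) (v≗v′ fzero)) (φ-cong (u≗u′ ∘ fsuc) (v≗v′ ∘ fsuc))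

φ-zeroˡ : (v : Vector k) → φ (replicate k false) v ≡ false
φ-zeroˡ {zero}  v = refl
φ-zeroˡ {suc k} v = φ-zeroˡ (v ∘ fsuc)

φ-zeroʳ : (u : Vector k) → φ u (replicate k false) ≡ false
φ-zeroʳ {zero}  u = refl
φ-zeroʳ {suc k} u = trans (cong (_xor φ (u ∘ fsuc) (replicate k false)) (∧-zeroʳ (u fzero)))
                          (φ-zeroʳ (u ∘ fsuc))

xor-interchange : ∀ a b c d → (a xor b) xor (c xor d) ≡ (a xor c) xor (b xor d)
xor-interchange a b c d = begin
  (a xor b) xor (c xor d)   ≡⟨ xor-assoc a b (c xor d) ⟩
  a xor (b xor (c xor d))   ≡⟨ cong (a xor_) (sym (xor-assoc b c d)) ⟩
  a xor ((b xor c) xor d)   ≡⟨ cong (λ x → a xor (x xor d)) (xor-comm b c) ⟩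
  a xor ((c xor b) xor d)   ≡⟨ cong (a xor_) (xor-assoc c b d) ⟩
  a xor (c xor (b xor d))   ≡⟨ sym (xor-assoc a c (b xor d)) ⟩
  (a xor c) xor (b xor d)   ∎

φ-⊕ˡ : (u v w : Vector k) → φ (u ⊕ v) w ≡ φ u w xor φ v w
φ-⊕ˡ {zero}  u v w = refl
φ-⊕ˡ {suc k} u v w = begin
  ((u₀ xor v₀) ∧ w₀) xor φ (u′ ⊕ v′) w′
    ≡⟨ cong₂ _xor_ (∧-distribʳ-xor w₀ u₀ v₀) (φ-⊕ˡ u′ v′ w′) ⟩
  ((u₀ ∧ w₀) xor (v₀ ∧ w₀)) xor (φ u′ w′ xor φ v′ w′)
    ≡⟨ xor-interchange (u₀ ∧ w₀) (v₀ ∧ w₀) (φ u′ w′) (φ v′ w′) ⟩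
  ((u₀ ∧ w₀) xor φ u′ w′) xor ((v₀ ∧ w₀) xor φ v′ w′)
    ∎
  where
  u₀ v₀ w₀ : Bool
  u₀ = u fzero; v₀ = v fzero; w₀ = w fzero
  u′ v′ w′ : Vector k
  u′ = u ∘ fsuc; v′ = v ∘ fsuc; w′ = w ∘ fsuc

φ-·ˡ : ∀ β (v w : Vector k) → φ (β · v) w ≡ β ∧ φ v w
φ-·ˡ false v w = φ-zeroˡ w
φ-·ˡ true  v w = refl

φ-punchIn : ∀ (c : Fin (suc k)) (u v : Vector (suc k)) →
            φ u v ≡ (u c ∧ v c) xor φ (dropCoordinate c u) (dropCoordinate c v)
φ-punchIn fzero    u v = refl
φ-punchIn {suc k} (fsuc c) u v = begin
  head xor φ (u ∘ fsuc) (v ∘ fsuc)    ≡⟨ cong (head xor_) (φ-punchIn c (u ∘ fsuc) (v ∘ fsuc)) ⟩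
  head xor (at-c xor rest)            ≡⟨ sym (xor-assoc head at-c rest) ⟩
  (head xor at-c) xor rest            ≡⟨ cong (_xor rest) (xor-comm head at-c) ⟩
  (at-c xor head) xor rest            ≡⟨ xor-assoc at-c head rest ⟩
  at-c xor (head xor rest)            ∎
  where
  head at-c rest : Bool
  head = u fzero ∧ v fzero
  at-c = u (fsuc c) ∧ v (fsuc c)
  rest = φ (dropCoordinate c (u ∘ fsuc)) (dropCoordinate c (v ∘ fsuc))

φ≡true⇒nonzero : (u v : Vector k) → φ u v ≡ true → ∃ λ c → u c ≡ true
φ≡true⇒nonzero {zero}  u v ()
φ≡true⇒nonzero {suc k} u v φuv with u fzero in u₀
... | true  = fzero , u₀
... | false with φ≡true⇒nonzero (u ∘ fsuc) (v ∘ fsuc) φuv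
...   | c , uc≡true = fsuc c , uc≡true

isOdd : ℕ → Bool
isOdd zero          = false
isOdd (suc zero)    = true
isOdd (suc (suc n)) = isOdd n

isOdd-suc : ∀ n → isOdd (suc n) ≡ not (isOdd n)
isOdd-suc zero          = refl
isOdd-suc (suc zero)    = refl
isOdd-suc (suc (suc n)) = isOdd-suc n

isOdd≡true⇔Odd : ∀ n → isOdd n ≡ true ⇔ Odd n
isOdd≡true⇔Odd zero          = mk⇔ (λ ()) (λ ())
isOdd≡true⇔Odd (suc zero)    = mk⇔ (λ _ → refl) (λ _ → refl)
isOdd≡true⇔Odd (suc (suc n)) = isOdd≡true⇔Odd n

φ≡isOdd-count : (u v : Vector k) → φ u v ≡ isOdd (count (λ i → u i ∧ v i))
φ≡isOdd-count {zero}  u v = refl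
φ≡isOdd-count {suc k} u v with u fzero ∧ v fzero
... | false = φ≡isOdd-count (u ∘ fsuc) (v ∘ fsuc)
... | true  = trans (cong not (φ≡isOdd-count (u ∘ fsuc) (v ∘ fsuc)))
                    (sym (isOdd-suc (count (λ i → u (fsuc i) ∧ v (fsuc i)))))

φ≡true⇔Odd-count : (u v : Vector k) → φ u v ≡ true ⇔ Odd (count (λ i → u i ∧ v i))
φ≡true⇔Odd-count u v rewrite φ≡isOdd-count u v = isOdd≡true⇔Odd (count (λ i → u i ∧ v i))

≡⇔≡true⇔≡true : (b c : Bool) → b ≡ c ⇔ (b ≡ true ⇔ c ≡ true)
≡⇔≡true⇔≡true b c = mk⇔ (λ { refl → mk⇔ (λ x → x) (λ x → x) }) (from-⇔ b c)
  where
  from-⇔ : ∀ b c → (b ≡ true ⇔ c ≡ true) → b ≡ c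
  from-⇔ false false _ = refl
  from-⇔ false true  e = from e refl
  from-⇔ true  false e = sym (to e refl)
  from-⇔ true  true  _ = refl

representable⇔hasSubsetCover : {V : Set} (G : Graph V) (m : ℕ) →
                                Representable G m ⇔ HasSubsetCover G m
representable⇔hasSubsetCover {V} G m =
  mk⇔ (λ (f , r) → (λ i x → f x i) , λ x y x≢y → to (pair⇔ (λ i x → f x i) x y) (r x y x≢y))
      (λ (X , c) → (λ x i → X i x) , λ x y x≢y → from (pair⇔ X x y) (c x y x≢y))
  where
  pair⇔ : (X : Fin m → V → Bool) → ∀ x y →
          (adj G x y ≡ φ (λ i → X i x) (λ i → X i y)) ⇔
          (adj G x y ≡ true ⇔ Odd (count (λ i → X i x ∧ X i y)))
  pair⇔ X x y = mk⇔ (λ e → φ≡true⇔Odd ⇔-∘ to (≡⇔≡true⇔≡true _ _) e)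
                    (λ e → from (≡⇔≡true⇔≡true _ _) (⇔-sym φ≡true⇔Odd ⇔-∘ e))
    where
    φ≡true⇔Odd : φ (λ i → X i x) (λ i → X i y) ≡ true ⇔ Odd (count (λ i → X i x ∧ X i y))
    φ≡true⇔Odd = φ≡true⇔Odd-count (λ i → X i x) (λ i → X i y)


Represents : {V : Set} → (V → V → Bool) → (V → Vector m) → Set
Represents a f = ∀ x y → x ≢ y → a x y ≡ φ (f x) (f y)

xor-cancelˡ : ∀ a b → b xor (a xor b) ≡ a
xor-cancelˡ false false = refl
xor-cancelˡ false true  = refl
xor-cancelˡ true  false = refl
xor-cancelˡ true  true  = refl

-- The recursion passes through matrices with a nonzero diagonal, hence symmetric matrices rather than graphs.
symmetric⇒representable : (a : Fin (suc n) → Fin (suc n) → Bool) → (∀ x y → a x y ≡ a y x) →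
                          ∃ λ (f : Fin (suc n) → Vector n) → Represents a f
symmetric⇒representable {zero}  a a-sym = (λ _ ()) , λ { fzero fzero 0≢0 → ⊥-elim (0≢0 refl) }
symmetric⇒representable {suc n} a a-sym = f , f-represents
  where
  neighbour : Fin (suc n) → Bool
  neighbour y = a fzero (fsuc y)

  residual : Fin (suc n) → Fin (suc n) → Bool
  residual x y = a (fsuc x) (fsuc y) xor (neighbour x ∧ neighbour y)

  residual-sym : ∀ x y → residual x y ≡ residual y x
  residual-sym x y = cong₂ _xor_ (a-sym (fsuc x) (fsuc y)) (∧-comm (neighbour x) (neighbour y))

  g : Fin (suc n) → Vector n
  g = proj₁ (symmetric⇒representable residual residual-sym)

  g-represents : Represents residual g
  g-represents = proj₂ (symmetric⇒representable residual residual-sym)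

  f : Fin (suc (suc n)) → Vector (suc n)
  f fzero    = true ◂ replicate n false
  f (fsuc y) = neighbour y ◂ g y

  f-represents : Represents a f
  f-represents fzero    fzero    0≢0 = ⊥-elim (0≢0 refl)
  f-represents fzero    (fsuc y) _   = sym (begin
    neighbour y xor φ (replicate n false) (g y)   ≡⟨ cong (neighbour y xor_) (φ-zeroˡ (g y)) ⟩
    neighbour y xor false                         ≡⟨ xor-identityʳ _ ⟩
    neighbour y                                   ∎)
  f-represents (fsuc x) fzero    _   = begin
    a (fsuc x) fzero                                     ≡⟨ a-sym (fsuc x) fzero ⟩
    neighbour x                                          ≡⟨ sym (xor-identityʳ (neighbour x)) ⟩
    neighbour x xor false
      ≡⟨ sym (cong₂ _xor_ (∧-identityʳ (neighbour x)) (φ-zeroʳ (g x))) ⟩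
    (neighbour x ∧ true) xor φ (g x) (replicate n false)  ∎
  f-represents (fsuc x) (fsuc y) x≢y = begin
    a (fsuc x) (fsuc y)                            ≡⟨ sym (xor-cancelˡ (a (fsuc x) (fsuc y)) both) ⟩
    both xor residual x y
      ≡⟨ cong (both xor_) (g-represents x y (x≢y ∘ cong fsuc)) ⟩
    both xor φ (g x) (g y)                         ∎
    where
    both : Bool
    both = neighbour x ∧ neighbour y

representable-n∸1 : (G : Graph (Fin n)) → Representable G (n ∸ 1)
representable-n∸1 {zero}  G = (λ ()) , λ ()
representable-n∸1 {suc n} G = symmetric⇒representable (adj G) (Graph.sym G)

Triangular : (u w : Fin m → Vector k) → Set
Triangular u w = (∀ i → φ (u i) (w i) ≡ true) × (∀ {i j} → i <ᶠ j → φ (u i) (w j) ≡ false)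

φ-eliminate : (c : Fin (suc k)) (p a b : Vector (suc k)) → p c ≡ true → φ p b ≡ false →
              φ (dropCoordinate c (a ⊕ a c · p)) (dropCoordinate c b) ≡ φ a b
φ-eliminate {k} c p a b pc≡true φpb = begin
  dropped                           ≡⟨ cong (λ x → (x ∧ b c) xor dropped) (sym a′c≡false) ⟩
  (a′ c ∧ b c) xor dropped          ≡⟨ sym (φ-punchIn c a′ b) ⟩
  φ (a ⊕ a c · p) b                 ≡⟨ φ-⊕ˡ a (a c · p) b ⟩
  φ a b xor φ (a c · p) b           ≡⟨ cong (φ a b xor_) (φ-·ˡ (a c) p b) ⟩
  φ a b xor (a c ∧ φ p b)           ≡⟨ cong (λ x → φ a b xor (a c ∧ x)) φpb ⟩
  φ a b xor (a c ∧ false)           ≡⟨ cong (φ a b xor_) (∧-zeroʳ (a c)) ⟩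
  φ a b xor false                   ≡⟨ xor-identityʳ (φ a b) ⟩
  φ a b                             ∎
  where
  a′ : Vector (suc k)
  a′ = a ⊕ a c · p

  dropped : Bool
  dropped = φ (dropCoordinate c a′) (dropCoordinate c b)

  a′c≡false : a′ c ≡ false
  a′c≡false = begin
    a c xor (a c ∧ p c)   ≡⟨ cong (λ x → a c xor (a c ∧ x)) pc≡true ⟩
    a c xor (a c ∧ true)  ≡⟨ cong (a c xor_) (∧-identityʳ (a c)) ⟩
    a c xor a c           ≡⟨ xor-same (a c) ⟩
    false                 ∎

triangular⇒≤ : (u w : Fin m → Vector k) → Triangular u w → m ≤ k
triangular⇒≤ {zero}          u w _ = z≤n
triangular⇒≤ {suc m} {zero}  u w (diagonal , _) with () ← diagonal fzero
triangular⇒≤ {suc m} {suc k} u w (diagonal , upper)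
  with c , u₀c≡true ← φ≡true⇒nonzero (u fzero) (w fzero) (diagonal fzero) =
  s≤s (triangular⇒≤ u′ w′ ((λ i → trans (eliminate i i) (diagonal (fsuc i))) ,
                          λ {i} {j} i<j → trans (eliminate i j) (upper {fsuc i} {fsuc j} (s≤s i<j))))
  where
  u′ w′ : Fin m → Vector k
  u′ i = dropCoordinate c (u (fsuc i) ⊕ u (fsuc i) c · u fzero)
  w′ j = dropCoordinate c (w (fsuc j))

  eliminate : ∀ i j → φ (u′ i) (w′ j) ≡ φ (u (fsuc i)) (w (fsuc j))
  eliminate i j = φ-eliminate c (u fzero) (u (fsuc i)) (w (fsuc j)) u₀c≡true (upper (s≤s z≤n))

InducedPath : {V : Set} → Graph V → (Fin n → V) → Set
InducedPath {n} G σ = Injective _≡_ _≡_ σ ×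
  (∀ (i j : Fin n) → (adj G (σ i) (σ j) ≡ true ⇔ (suc (toℕ i) ≡ toℕ j ⊎ suc (toℕ j) ≡ toℕ i)))

inducedPath⇒≤ : {V : Set} (G : Graph V) (σ : Fin (suc m) → V) → InducedPath G σ →
                Representable G k → m ≤ k
inducedPath⇒≤ {m} G σ (σ-injective , σ-path) (f , f-represents) =
  triangular⇒≤ u w (diagonal , upper)
  where
  u w : Fin m → Vector _
  u i = f (σ (inject₁ i))
  w j = f (σ (fsuc j))

  σ-distinct : ∀ {a b} → toℕ a ≢ toℕ b → σ a ≢ σ b
  σ-distinct toℕa≢toℕb = toℕa≢toℕb ∘ cong toℕ ∘ σ-injective

  diagonal : ∀ i → φ (u i) (w i) ≡ true
  diagonal i = trans (sym (f-represents _ _ (σ-distinct inject₁i≢suci)))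
                     (from (σ-path (inject₁ i) (fsuc i)) (inj₁ (cong suc (toℕ-inject₁ i))))
    where
    inject₁i≢suci : toℕ (inject₁ i) ≢ suc (toℕ i)
    inject₁i≢suci rewrite toℕ-inject₁ i = 1+n≢n ∘ sym

  upper : ∀ {i j} → i <ᶠ j → φ (u i) (w j) ≡ false
  upper {i} {j} i<j = trans (sym (f-represents _ _ (σ-distinct (<⇒≢ i<suc-j))))
                            (¬-not (not-adjacent ∘ to (σ-path (inject₁ i) (fsuc j))))
    where
    i′<j : toℕ (inject₁ i) < toℕ j
    i′<j rewrite toℕ-inject₁ i = i<j
    i<suc-j : toℕ (inject₁ i) < suc (toℕ j)
    i<suc-j = m<n⇒m<1+n i′<j
    not-adjacent : ¬ (suc (toℕ (inject₁ i)) ≡ suc (toℕ j) ⊎ suc (suc (toℕ j)) ≡ toℕ (inject₁ i))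
    not-adjacent (inj₁ e) = <⇒≢ i′<j (suc-injective e)
    not-adjacent (inj₂ e) = <⇒≱ i<suc-j (subst (suc (toℕ j) ≤_) e (n≤1+n _))

Least : (ℕ → Set) → ℕ → Set
Least P m = P m × (∀ k → k < m → ¬ P k)

Least-cong : {P Q : ℕ → Set} → (∀ k → P k ⇔ Q k) → Least P m ⇔ Least Q m
Least-cong P⇔Q = mk⇔ (λ (p , below) → to (P⇔Q _) p , λ k k<m → below k k<m ∘ from (P⇔Q k))
                     (λ (q , below) → from (P⇔Q _) q , λ k k<m → below k k<m ∘ to (P⇔Q k))

least-witness : {P : ℕ → Set} → Decidable P → P n → ∃[ m ] (Least P m × m ≤ n)
least-witness {zero}  P? p = zero , (p , λ _ ()) , z≤n
least-witness {suc n} {P} P? p with P? zero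
... | yes p₀ = zero , (p₀ , λ _ ()) , z≤n
... | no ¬p₀ with m , (pm , below) , m≤n ← least-witness {P = P ∘ suc} (P? ∘ suc) p =
  suc m , (pm , below′) , s≤s m≤n
  where
  below′ : ∀ k → k < suc m → ¬ P k
  below′ zero    _       = ¬p₀
  below′ (suc k) (s≤s k<m) = below k k<m

Exhaustible : Set → Set₁
Exhaustible A = ∀ {P : A → Set} → Decidable P → Dec (∃ P)

Bool-exhaustible : Exhaustible Bool
Bool-exhaustible P? = map′ (λ { (inj₁ p) → true , p ; (inj₂ p) → false , p })
                           (λ { (true , p) → inj₁ p ; (false , p) → inj₂ p })
                           (P? true ⊎-dec P? false)

Vec-exhaustible : {A : Set} → Exhaustible A → ∀ n → Exhaustible (Vec A n)
Vec-exhaustible A? zero    P? = map′ ([] ,_) (λ { ([] , p) → p }) (P? [])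
Vec-exhaustible A? (suc n) P? =
  map′ (λ (a , as , p) → a ∷ as , p) (λ { (a ∷ as , p) → a , as , p })
       (A? λ a → Vec-exhaustible A? n (P? ∘ (a ∷_)))

representable-dec : (G : Graph (Fin n)) → Decidable (Representable G)
representable-dec {n} G k =
  map′ (λ (F , r) → toFunction F , r) (λ (f , r) → fromFunction f , respects f r)
       (Vec-exhaustible (Vec-exhaustible Bool-exhaustible k) n (Representation? ∘ toFunction))
  where
  toFunction : Vec (Vec Bool k) n → Fin n → Vector k
  toFunction F x i = lookup (lookup F x) i

  fromFunction : (Fin n → Vector k) → Vec (Vec Bool k) n
  fromFunction f = tabulate (tabulate ∘ f)

  toFunction-fromFunction : ∀ f x i → toFunction (fromFunction f) x i ≡ f x i
  toFunction-fromFunction f x i rewrite lookup∘tabulate (tabulate ∘ f) x = lookup∘tabulate (f x) i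

  respects : ∀ f → Representation G k f → Representation G k (toFunction (fromFunction f))
  respects f r x y x≢y = trans (r x y x≢y) (φ-cong (sym ∘ toFunction-fromFunction f x)
                                                  (sym ∘ toFunction-fromFunction f y))

  Representation? : Decidable (Representation G k)
  Representation? f = all? λ x → all? λ y → ¬? (x ≟ᶠ y) →-dec (adj G x y ≟ᵇ φ (f x) (f y))

booleanDimension⇔leastSubsetCoverSize : {V : Set} (G : Graph V) (m : ℕ) →
                                       IsBooleanDimension G m ⇔ IsLeastSubsetCoverSize G m
booleanDimension⇔leastSubsetCoverSize G m = Least-cong (representable⇔hasSubsetCover G)

booleanDimension≤n∸1 : (n : ℕ) (G : Graph (Fin n)) → ∃[ m ] (IsBooleanDimension G m × m ≤ n ∸ 1)
booleanDimension≤n∸1 n G = least-witness (representable-dec G) (representable-n∸1 G)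

path⇒booleanDimension≡n∸1 : (n : ℕ) (G : Graph (Fin n)) → IsPath G → IsBooleanDimension G (n ∸ 1)
path⇒booleanDimension≡n∸1 zero    G _              = representable-n∸1 G , λ _ ()
path⇒booleanDimension≡n∸1 (suc n) G (σ , σ-path) =
  representable-n∸1 G , λ k k<n → <⇒≱ k<n ∘ inducedPath⇒≤ G σ σ-path

proposition1 : (∀ {V : Set} (G : Graph V) (m : ℕ) → (IsBooleanDimension G m ⇔ IsLeastSubsetCoverSize G m))
    × (∀ (n : ℕ) (G : Graph (Fin n)) → ∃[ m ] (IsBooleanDimension G m × m ≤ n ∸ 1))
    × (∀ (n : ℕ) (G : Graph (Fin n)) → IsPath G → IsBooleanDimension G (n ∸ 1))
proposition1 = booleanDimension⇔leastSubsetCoverSize , booleanDimension≤n∸1 , path⇒booleanDimension≡n∸1
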